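{- Let $\Gamma$ be a finite connected simple graph with a perfect matching $\mathcal{M} = \{e_i = \{\alpha_i,\beta_i\} : 1 \le i \le m\}$, $m \ge 2$, such that the setwise stabilizer of $\mathcal{M}$ in $\operatorname{Aut}(\Gamma)$ acts $2$-transitively on the edges of $\mathcal{M}$. If $\Gamma[\alpha_1,\beta_1,\alpha_2,\beta_2] \cong P_4$ and $\Gamma$ is not regular, then $\Gamma \cong K_m \veebar \overline{K}_m$. If $\Gamma[\alpha_1,\beta_1,\alpha_2,\beta_2] \cong K_4 \setminus \{e\}$ and $\Gamma$ is not regular, then $\Gamma \cong K_m \vee \overline{K}_m$.
   Context: $\Gamma[X]$ denotes the subgraph induced on the vertex set $X$. $P_4$ is the path with four vertices and $K_4\setminus\{e\}$ is $K_4$ with one edge removed. $\overline{K}_m$ is the edgeless graph on $m$ vertices. $K_m \veebar \overline{K}_m$ is the disjoint union of $K_m$ and $\overline{K}_m$ together with a perfect matching between their vertex sets; $K_m \vee \overline{K}_m$ is the disjoint union of $K_m$ and $\overline{K}_m$ together with all edges between their vertex sets. -}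

module Defs where

open import Data.Nat using (ℕ; zero; suc; _+_; _*_; _≡ᵇ_)
open import Data.Bool using (Bool; true; false; not; _∧_; _∨_; if_then_else_)
open import Data.Fin using (Fin; toℕ; _≟_)
import Data.Fin as Fin
open import Data.Sum using (_⊎_; inj₁; inj₂; [_,_])
open import Data.Product using (Σ; ∃; ∃-syntax; _×_; _,_)
open import Data.List using (List; map; allFin)
open import Data.Nat.ListAction using (sum)
open import Relation.Binary.PropositionalEquality using (_≡_; _≢_)
open import Relation.Nullary using (¬_)
open import Relation.Nullary.Decidable using (⌊_⌋)
open import Function.Bundles using (_↔_; Inverse)
open import Function.Definitions using (Bijective)

record Graph (V : Set) : Set where
  field
    adj    : V → V → Bool
    sym    : ∀ u v → adj u v ≡ adj v u
    irrefl : ∀ v → adj v v ≡ false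
open Graph public

data Reach {V : Set} (G : Graph V) (u : V) : V → Set where
  here : Reach G u u
  step : ∀ {v w} → Reach G u v → adj G v w ≡ true → Reach G u w

Connected : {V : Set} → Graph V → Set
Connected G = ∀ u v → Reach G u v

degree : {n : ℕ} → Graph (Fin n) → Fin n → ℕ
degree {n} G v = sum (map (λ u → if adj G v u then 1 else 0) (allFin n))

Regular : {n : ℕ} → Graph (Fin n) → Set
Regular {n} G = ∃[ k ] (∀ v → degree G v ≡ k)

_≅ᵃ_ : {V W : Set} → (V → V → Bool) → (W → W → Bool) → Set
_≅ᵃ_ {V} {W} a b = Σ (V ↔ W) λ φ → ∀ u v → a u v ≡ b (Inverse.to φ u) (Inverse.to φ v)

IsAut : {V : Set} → Graph V → (V ↔ V) → Set
IsAut G σ = ∀ u v → adj G u v ≡ adj G (Inverse.to σ u) (Inverse.to σ v)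

IsPerfectMatching : {n m : ℕ} → Graph (Fin n) → (α β : Fin m → Fin n) → Set
IsPerfectMatching G α β =
  (∀ i → adj G (α i) (β i) ≡ true) × Bijective _≡_ _≡_ [ α , β ]

MapsEdge : {n m : ℕ} → (α β : Fin m → Fin n) → (Fin n ↔ Fin n) → Fin m → Fin m → Set
MapsEdge α β σ i j =
  (Inverse.to σ (α i) ≡ α j × Inverse.to σ (β i) ≡ β j)
  ⊎ (Inverse.to σ (α i) ≡ β j × Inverse.to σ (β i) ≡ α j)

StabilizesM : {n m : ℕ} → (α β : Fin m → Fin n) → (Fin n ↔ Fin n) → Set
StabilizesM {m = m} α β σ = ∀ (i : Fin m) → ∃[ j ] MapsEdge α β σ i j

StabTwoTransitive : {n m : ℕ} → Graph (Fin n) → (α β : Fin m → Fin n) → Set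
StabTwoTransitive {n} {m} G α β =
  ∀ (i j k l : Fin m) → i ≢ j → k ≢ l →
    Σ (Fin n ↔ Fin n) λ σ →
      IsAut G σ × StabilizesM α β σ × MapsEdge α β σ i k × MapsEdge α β σ j l

P4 : Fin 4 → Fin 4 → Bool
P4 i j = (suc (toℕ i) ≡ᵇ toℕ j) ∨ (suc (toℕ j) ≡ᵇ toℕ i)

-- K4 minus the edge {0,3}
K4-e : Fin 4 → Fin 4 → Bool
K4-e i j = not (toℕ i ≡ᵇ toℕ j) ∧ not ((toℕ i * toℕ j ≡ᵇ 0) ∧ (toℕ i + toℕ j ≡ᵇ 3))

induced4 : {n : ℕ} → Graph (Fin n) → (Fin 4 → Fin n) → Fin 4 → Fin 4 → Bool
induced4 G v i j = adj G (v i) (v j)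

-- K_m ⊻ \bar K_m on Fin m ⊎ Fin m (inj₁ = clique side, inj₂ = independent side)
KmVeebar : (m : ℕ) → Fin m ⊎ Fin m → Fin m ⊎ Fin m → Bool
KmVeebar m (inj₁ i) (inj₁ j) = not ⌊ i ≟ j ⌋
KmVeebar m (inj₁ i) (inj₂ j) = ⌊ i ≟ j ⌋
KmVeebar m (inj₂ i) (inj₁ j) = ⌊ i ≟ j ⌋
KmVeebar m (inj₂ i) (inj₂ j) = false

KmVee : (m : ℕ) → Fin m ⊎ Fin m → Fin m ⊎ Fin m → Bool
KmVee m (inj₁ i) (inj₁ j) = not ⌊ i ≟ j ⌋
KmVee m (inj₁ i) (inj₂ j) = true
KmVee m (inj₂ i) (inj₁ j) = true
KmVee m (inj₂ i) (inj₂ j) = false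

-- the four vertices α₁, β₁, α₂, β₂ (indices zero and suc zero of Fin (2+k))
fourVerts : {n k : ℕ} → (α β : Fin (suc (suc k)) → Fin n) → Fin 4 → Fin n
fourVerts α β Fin.zero = α Fin.zero
fourVerts α β (Fin.suc Fin.zero) = β Fin.zero
fourVerts α β (Fin.suc (Fin.suc Fin.zero)) = α (Fin.suc Fin.zero)
fourVerts α β (Fin.suc (Fin.suc (Fin.suc Fin.zero))) = β (Fin.suc Fin.zero)

-- Call the 2 × 2 adjacency pattern between the endpoints of two matching edges their block. P4 has three
-- edges and K4 − e five, two of which are the matching edges e₁ and e₂, so the block of (e₁, e₂) has exactly
-- one edge, resp. exactly one non-edge: a single odd cell. The 2-transitive stabilizer of M carries this to
-- the block of every pair of matching edges. No element of the stabilizer swaps the endpoints of a matching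
-- edge, since together with edge-transitivity this would make Aut(Γ) vertex-transitive and Γ regular. Hence
-- the row of the odd cell in the block of (eᵢ, eⱼ) depends on i alone, which singles out one endpoint of
-- each eᵢ. These endpoints form a clique and the others a coclique (P4), or the reverse, with all other
-- cross pairs adjacent (K4 − e).
module Submission where

open import Defs hiding (sym)
open import Data.Nat using (ℕ; suc; _+_; _*_)
open import Data.Fin using (Fin; zero; suc; _≟_)
open import Data.Product using (_×_; ∃; ∃₂; _,_; proj₁; proj₂)
open import Relation.Nullary using (¬_; yes; no)

import Algebra.Properties.CommutativeMonoid.Sum as CommutativeMonoidSum
open import Data.Bool using (Bool; true; false; not; _∨_; _xor_; if_then_else_)
open import Data.Bool.Properties
  using ( xor-assoc; xor-same; xor-identityʳ; xor-annihilates-not; not-involutive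
        ; ∨-comm; ∨-conicalˡ; ∨-conicalʳ; if-eta)
open import Data.Empty using (⊥-elim)
open import Data.List using ([]; _∷_; map; allFin; tabulate)
open import Data.List.Properties using (map-tabulate)
open import Data.Nat.ListAction using (sum)
open import Data.Nat.Properties using (+-0-commutativeMonoid; +-cancelˡ-≡; *-cancelˡ-≡)
open import Data.Nat.Tactic.RingSolver using (solve)
open import Data.Sum using (_⊎_; inj₁; inj₂; [_,_]; reduce)
open import Function using (_∘_)
open import Function.Bundles using (_↔_; Inverse; mk↔ₛ′; mk⤖)
open import Function.Properties.Bijection using (⤖⇒↔)
open import Function.Properties.Inverse using (↔-sym; ↔-trans)
open import Relation.Binary.PropositionalEquality
  using (_≡_; _≢_; refl; sym; trans; cong; cong₂; subst₂; module ≡-Reasoning)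
open import Relation.Nullary.Decidable using (⌊_⌋)

open CommutativeMonoidSum +-0-commutativeMonoid
  using (sum-permute; sum-cong-≗) renaming (sum to ∑)
open Inverse using (to; from)

xor-cancelˡ : ∀ s b → s xor (s xor b) ≡ b
xor-cancelˡ false b = refl
xor-cancelˡ true  b = not-involutive b

xor-cancel-common : ∀ c a b → (c xor a) xor (c xor b) ≡ a xor b
xor-cancel-common false a b = refl
xor-cancel-common true  a b = xor-annihilates-not a b

xor≡false⇒≡ : ∀ {a b} → a xor b ≡ false → a ≡ b
xor≡false⇒≡ {a} {b} e = trans (sym (xor-identityʳ a)) (trans (cong (a xor_) (sym e)) (xor-cancelˡ a b))

if-true-false : ∀ b → (if b then true else false) ≡ b
if-true-false false = refl
if-true-false true  = refl

if-false-true : ∀ b → (if b then false else true) ≡ not b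
if-false-true false = refl
if-false-true true  = refl

-- The Boolean 2 × 2 matrix (rows b, columns c) that is w at (p , q) and not w at the other three cells.
oneCell : Bool → Bool → Bool → Bool → Bool → Bool
oneCell w p q b c = w xor ((p xor b) ∨ (q xor c))

oneCell-shift : ∀ w p q s t b c → oneCell w p q (s xor b) (t xor c) ≡ oneCell w (p xor s) (q xor t) b c
oneCell-shift w p q s t b c = cong (w xor_) (sym (cong₂ _∨_ (xor-assoc p s b) (xor-assoc q t c)))

oneCell-transpose : ∀ w p q b c → oneCell w p q c b ≡ oneCell w q p b c
oneCell-transpose w p q b c = cong (w xor_) (∨-comm (p xor c) (q xor b))

oneCell-injective : ∀ {w p q p′ q′} → (∀ b c → oneCell w p q b c ≡ oneCell w p′ q′ b c) → p′ ≡ p × q′ ≡ q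
oneCell-injective {w} {p} {q} {p′} {q′} same =
  xor≡false⇒≡ (∨-conicalˡ _ _ odd) , xor≡false⇒≡ (∨-conicalʳ _ _ odd)
  where
  odd : (p′ xor p) ∨ (q′ xor q) ≡ false
  odd = begin
    (p′ xor p) ∨ (q′ xor q)    ≡⟨ sym (xor-cancelˡ w _) ⟩
    w xor oneCell w p′ q′ p q  ≡⟨ cong (w xor_) (sym (same p q)) ⟩
    w xor oneCell w p q p q    ≡⟨ cong (λ d → w xor (w xor d)) (cong₂ _∨_ (xor-same p) (xor-same q)) ⟩
    w xor (w xor false)        ≡⟨ xor-cancelˡ w false ⟩
    false                      ∎
    where open ≡-Reasoning

OneCell : Bool → (Bool → Bool → Bool) → Set
OneCell w f = ∃₂ λ p q → ∀ b c → f b c ≡ oneCell w p q b c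

OneCell-resp : ∀ {w} {f g : Bool → Bool → Bool} → (∀ b c → f b c ≡ g b c) → OneCell w g → OneCell w f
OneCell-resp f≗g (p , q , g≗) = p , q , λ b c → trans (f≗g b c) (g≗ b c)

matrix : Bool → Bool → Bool → Bool → Bool → Bool → Bool
matrix a _ _ _ false false = a
matrix _ b _ _ false true  = b
matrix _ _ c _ true  false = c
matrix _ _ _ d true  true  = d

cells-ext : ∀ {f g : Bool → Bool → Bool} →
  f false false ≡ g false false → f false true ≡ g false true →
  f true false ≡ g true false → f true true ≡ g true true → ∀ b c → f b c ≡ g b c
cells-ext e _ _ _ false false = e
cells-ext _ e _ _ false true  = e
cells-ext _ _ e _ true  false = e
cells-ext _ _ _ e true  true  = e

matrix-entries : ∀ f b c → f b c ≡ matrix (f false false) (f false true) (f true false) (f true true) b c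
matrix-entries f = cells-ext {f = f} {g = matrix (f false false) (f false true) (f true false) (f true true)}
  refl refl refl refl

indicator : Bool → ℕ
indicator false = 0
indicator true  = 1

cellCount : (Bool → Bool → Bool) → ℕ
cellCount f =
  indicator (f false false) + indicator (f false true) + indicator (f true false) + indicator (f true true)

matrix-count≡1 : ∀ a b c d → cellCount (matrix a b c d) ≡ 1 → OneCell true (matrix a b c d)
matrix-count≡1 true  true  _     _     ()
matrix-count≡1 true  false true  _     ()
matrix-count≡1 true  false false true  ()
matrix-count≡1 true  false false false _ = false , false , cells-ext refl refl refl refl
matrix-count≡1 false true  true  _     ()
matrix-count≡1 false true  false true  ()
matrix-count≡1 false true  false false _ = false , true , cells-ext refl refl refl refl
matrix-count≡1 false false true  true  ()
matrix-count≡1 false false true  false _ = true , false , cells-ext refl refl refl refl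
matrix-count≡1 false false false true  _ = true , true , cells-ext refl refl refl refl
matrix-count≡1 false false false false ()

matrix-count≡3 : ∀ a b c d → cellCount (matrix a b c d) ≡ 3 → OneCell false (matrix a b c d)
matrix-count≡3 true  true  true  true  ()
matrix-count≡3 true  true  true  false _ = true , true , cells-ext refl refl refl refl
matrix-count≡3 true  true  false true  _ = true , false , cells-ext refl refl refl refl
matrix-count≡3 true  true  false false ()
matrix-count≡3 true  false true  true  _ = false , true , cells-ext refl refl refl refl
matrix-count≡3 true  false true  false ()
matrix-count≡3 true  false false true  ()
matrix-count≡3 true  false false false ()
matrix-count≡3 false true  true  true  _ = false , false , cells-ext refl refl refl refl
matrix-count≡3 false true  true  false ()
matrix-count≡3 false true  false true  ()
matrix-count≡3 false true  false false ()
matrix-count≡3 false false true  true  ()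
matrix-count≡3 false false true  false ()
matrix-count≡3 false false false true  ()
matrix-count≡3 false false false false ()

cellCount≡1⇒OneCell : ∀ f → cellCount f ≡ 1 → OneCell true f
cellCount≡1⇒OneCell f n = OneCell-resp {true} (matrix-entries f)
  (matrix-count≡1 (f false false) (f false true) (f true false) (f true true) n)

cellCount≡3⇒OneCell : ∀ f → cellCount f ≡ 3 → OneCell false f
cellCount≡3⇒OneCell f n = OneCell-resp {false} (matrix-entries f)
  (matrix-count≡3 (f false false) (f false true) (f true false) (f true true) n)

2*[2+]-injective : ∀ {c d} → 2 * (2 + c) ≡ 2 * (2 + d) → c ≡ d
2*[2+]-injective {c} {d} e = +-cancelˡ-≡ 2 c d (*-cancelˡ-≡ (2 + c) (2 + d) 2 e)

sum-tabulate : ∀ {n} (f : Fin n → ℕ) → sum (tabulate f) ≡ ∑ f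
sum-tabulate {ℕ.zero} f = refl
sum-tabulate {suc n}  f = cong (f zero +_) (sum-tabulate (f ∘ suc))

sum-allFin : ∀ {n} (f : Fin n → ℕ) → sum (map f (allFin n)) ≡ ∑ f
sum-allFin f = trans (cong sum (map-tabulate (λ i → i) f)) (sum-tabulate f)

degree-aut : ∀ {n} (G : Graph (Fin n)) (σ : Fin n ↔ Fin n) → IsAut G σ → ∀ v → degree G (to σ v) ≡ degree G v
degree-aut G σ aut v = begin
  degree G (to σ v)                   ≡⟨ sum-allFin (row (to σ v)) ⟩
  ∑ (row (to σ v))                    ≡⟨ sum-permute (row (to σ v)) σ ⟩
  ∑ (λ u → row (to σ v) (to σ u))     ≡⟨ sum-cong-≗ (λ u → cong (if_then 1 else 0) (sym (aut v u))) ⟩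
  ∑ (row v)                           ≡⟨ sym (sum-allFin (row v)) ⟩
  degree G v                          ∎
  where
  open ≡-Reasoning
  row : _ → _ → ℕ
  row v u = if adj G v u then 1 else 0

arcCount : ∀ {n} → (Fin n → Fin n → Bool) → ℕ
arcCount a = ∑ λ u → ∑ λ v → indicator (a u v)

arcCount-≅ᵃ : ∀ {m n} {a : Fin m → Fin m → Bool} {b : Fin n → Fin n → Bool} → a ≅ᵃ b → arcCount b ≡ arcCount a
arcCount-≅ᵃ {a = a} {b} (φ , iso) = begin
  (∑ λ u → ∑ λ v → indicator (b u v))
    ≡⟨ sum-permute (λ u → ∑ λ v → indicator (b u v)) φ ⟩
  (∑ λ u → ∑ λ v → indicator (b (to φ u) v))
    ≡⟨ sum-cong-≗ (λ u → sum-permute (λ v → indicator (b (to φ u) v)) φ) ⟩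
  (∑ λ u → ∑ λ v → indicator (b (to φ u) (to φ v)))
    ≡⟨ sum-cong-≗ (λ u → sum-cong-≗ (λ v → cong indicator (sym (iso u v)))) ⟩
  (∑ λ u → ∑ λ v → indicator (a u v)) ∎
  where open ≡-Reasoning

≅ᵃ-via : ∀ {V W : Set} {a : V → V → Bool} {b : W → W → Bool} (ψ : W ↔ V) →
  (∀ x y → a (to ψ x) (to ψ y) ≡ b x y) → a ≅ᵃ b
≅ᵃ-via {a = a} ψ a≗b = ↔-sym ψ , λ u v →
  trans (cong₂ a (sym (Inverse.strictlyInverseˡ ψ u)) (sym (Inverse.strictlyInverseˡ ψ v))) (a≗b _ _)

tag : ∀ {A : Set} → Bool → A → A ⊎ A
tag false = inj₁
tag true  = inj₂

side : ∀ {A : Set} → A ⊎ A → Bool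
side (inj₁ _) = false
side (inj₂ _) = true

tag-side : ∀ {A : Set} (x : A ⊎ A) → tag (side x) (reduce x) ≡ x
tag-side (inj₁ _) = refl
tag-side (inj₂ _) = refl

flipSides : ∀ {A : Set} → (A → Bool) → A ⊎ A → A ⊎ A
flipSides c x = tag (c (reduce x) xor side x) (reduce x)

flipSides-tag : ∀ {A : Set} (c : A → Bool) s i → flipSides c (tag s i) ≡ tag (c i xor s) i
flipSides-tag c false i = refl
flipSides-tag c true  i = refl

flipSides-involutive : ∀ {A : Set} (c : A → Bool) x → flipSides c (flipSides c x) ≡ x
flipSides-involutive c x = begin
  flipSides c (tag (c i xor side x) i)  ≡⟨ flipSides-tag c _ i ⟩
  tag (c i xor (c i xor side x)) i      ≡⟨ cong (λ s → tag s i) (xor-cancelˡ (c i) (side x)) ⟩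
  tag (side x) i                        ≡⟨ tag-side x ⟩
  x                                     ∎
  where
  i = reduce x
  open ≡-Reasoning

-- K_m ⊻ K̄_m (w = true) and K_m ∨ K̄_m (w = false) as one family: inj₁ is the clique side, and between
-- distinct matching edges the odd cell is clique–clique (w = true) or coclique–coclique (w = false).
matchedSplit : Bool → (m : ℕ) → Fin m ⊎ Fin m → Fin m ⊎ Fin m → Bool
matchedSplit w m x y =
  if ⌊ reduce x ≟ reduce y ⌋ then side x xor side y else oneCell w (not w) (not w) (side x) (side y)

KmVeebar≗matchedSplit : ∀ m x y → KmVeebar m x y ≡ matchedSplit true m x y
KmVeebar≗matchedSplit m (inj₁ i) (inj₁ j) = sym (if-false-true ⌊ i ≟ j ⌋)
KmVeebar≗matchedSplit m (inj₁ i) (inj₂ j) = sym (if-true-false ⌊ i ≟ j ⌋)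
KmVeebar≗matchedSplit m (inj₂ i) (inj₁ j) = sym (if-true-false ⌊ i ≟ j ⌋)
KmVeebar≗matchedSplit m (inj₂ i) (inj₂ j) = sym (if-eta ⌊ i ≟ j ⌋)

KmVee≗matchedSplit : ∀ m x y → KmVee m x y ≡ matchedSplit false m x y
KmVee≗matchedSplit m (inj₁ i) (inj₁ j) = sym (if-false-true ⌊ i ≟ j ⌋)
KmVee≗matchedSplit m (inj₁ i) (inj₂ j) = sym (if-eta ⌊ i ≟ j ⌋)
KmVee≗matchedSplit m (inj₂ i) (inj₁ j) = sym (if-eta ⌊ i ≟ j ⌋)
KmVee≗matchedSplit m (inj₂ i) (inj₂ j) = sym (if-eta ⌊ i ≟ j ⌋)

other : ∀ {k} → Fin (suc (suc k)) → Fin (suc (suc k))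
other zero    = suc zero
other (suc _) = zero

other≢ : ∀ {k} (i : Fin (suc (suc k))) → i ≢ other i
other≢ zero    ()
other≢ (suc _) ()

module PerfectMatching {n m : ℕ} (G : Graph (Fin n)) (α β : Fin m → Fin n) (pm : IsPerfectMatching G α β) where

  end : Fin m → Bool → Fin n
  end i b = [ α , β ] (tag b i)

  block : Fin m → Fin m → Bool → Bool → Bool
  block i j b c = adj G (end i b) (end j c)

  block-diagonal : ∀ i b c → block i i b c ≡ b xor c
  block-diagonal i false false = irrefl G (α i)
  block-diagonal i false true  = proj₁ pm i
  block-diagonal i true  false = trans (Graph.sym G (β i) (α i)) (proj₁ pm i)
  block-diagonal i true  true  = irrefl G (β i)

  ends↔ : (Fin m ⊎ Fin m) ↔ Fin n
  ends↔ = ⤖⇒↔ (mk⤖ (proj₂ pm))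

  end-surjective : ∀ v → ∃₂ λ i b → end i b ≡ v
  end-surjective v = reduce x , side x , trans (cong [ α , β ] (tag-side x)) (Inverse.strictlyInverseˡ ends↔ v)
    where x = from ends↔ v

  record Sends (σ : Fin n ↔ Fin n) (i k : Fin m) (s : Bool) : Set where
    constructor sends
    field image : ∀ b → to σ (end i b) ≡ end k (s xor b)
  open Sends public

  orientation : ∀ σ i k → MapsEdge α β σ i k → ∃ (Sends σ i k)
  orientation _ _ _ (inj₁ (αα , ββ)) = false , sends λ { false → αα ; true → ββ }
  orientation _ _ _ (inj₂ (αβ , βα)) = true  , sends λ { false → αβ ; true → βα }

  block-transport : ∀ {σ i j k l s t} → IsAut G σ → Sends σ i k s → Sends σ j l t →
    ∀ b c → block k l b c ≡ block i j (s xor b) (t xor c)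
  block-transport {σ} {i} {j} {k} {l} {s} {t} aut σi σj b c = begin
    adj G (end k b) (end l c)
      ≡⟨ sym (cong₂ (λ b′ c′ → adj G (end k b′) (end l c′)) (xor-cancelˡ s b) (xor-cancelˡ t c)) ⟩
    adj G (end k (s xor (s xor b))) (end l (t xor (t xor c)))
      ≡⟨ sym (cong₂ (adj G) (image σi (s xor b)) (image σj (t xor c))) ⟩
    adj G (to σ (end i (s xor b))) (to σ (end j (t xor c)))
      ≡⟨ sym (aut _ _) ⟩
    block i j (s xor b) (t xor c) ∎
    where open ≡-Reasoning

  record OddCell (w : Bool) (i j : Fin m) (p q : Bool) : Set where
    constructor oddCell
    field entries : ∀ b c → block i j b c ≡ oneCell w p q b c
  open OddCell public

  oddCell-transport : ∀ {w σ i j k l s t p q} → IsAut G σ → Sends σ i k s → Sends σ j l t →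
    OddCell w i j p q → OddCell w k l (p xor s) (q xor t)
  oddCell-transport {w} {s = s} {t} {p} {q} aut σi σj P = oddCell λ b c →
    trans (block-transport aut σi σj b c) (trans (entries P _ _) (oneCell-shift w p q s t b c))

  oddCell-transpose : ∀ {w i j p q} → OddCell w i j p q → OddCell w j i q p
  oddCell-transpose {w} {p = p} {q} P = oddCell λ b c →
    trans (Graph.sym G _ _) (trans (entries P c b) (oneCell-transpose w p q b c))

  oddCell-unique : ∀ {w i j p q p′ q′} → OddCell w i j p q → OddCell w i j p′ q′ → p′ ≡ p × q′ ≡ q
  oddCell-unique {w} P P′ = oneCell-injective {w} (λ b c → trans (sym (entries P b c)) (entries P′ b c))

  relabel↔ : (Fin m → Bool) → (Fin m ⊎ Fin m) ↔ Fin n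
  relabel↔ c =
    ↔-trans (mk↔ₛ′ (flipSides c) (flipSides c) (flipSides-involutive c) (flipSides-involutive c)) ends↔

  relabel-diagonal : ∀ c x y → reduce x ≡ reduce y →
    adj G (to (relabel↔ c) x) (to (relabel↔ c) y) ≡ side x xor side y
  relabel-diagonal c x y e rewrite e =
    trans (block-diagonal i (c i xor side x) (c i xor side y)) (xor-cancel-common (c i) (side x) (side y))
    where i = reduce y

module EdgeTransitive {n k : ℕ} (G : Graph (Fin n)) (α β : Fin (suc (suc k)) → Fin n)
                      (pm : IsPerfectMatching G α β) (two : StabTwoTransitive G α β) where
  open PerfectMatching G α β pm

  -- Symmetry moves every cross entry into the block of (e₁, e₂); what remains is a semiring identity.
  arcCount-fourVerts : arcCount (induced4 G (fourVerts α β)) ≡ 2 * (2 + cellCount (block zero (suc zero)))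
  arcCount-fourVerts
    rewrite irrefl G (α zero) | irrefl G (β zero) | irrefl G (α (suc zero)) | irrefl G (β (suc zero))
          | Graph.sym G (β zero) (α zero) | proj₁ pm zero
          | Graph.sym G (β (suc zero)) (α (suc zero)) | proj₁ pm (suc zero)
          | Graph.sym G (α (suc zero)) (α zero) | Graph.sym G (β (suc zero)) (α zero)
          | Graph.sym G (α (suc zero)) (β zero) | Graph.sym G (β (suc zero)) (β zero)
    with indicator (block zero (suc zero) false false) | indicator (block zero (suc zero) false true)
       | indicator (block zero (suc zero) true false)  | indicator (block zero (suc zero) true true)
  ... | a | b | c | d = solve (a ∷ b ∷ c ∷ d ∷ [])

  oneCell⇒oddCell : ∀ {w} → OneCell w (block zero (suc zero)) → ∃₂ (OddCell w zero (suc zero))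
  oneCell⇒oddCell (p , q , P) = p , q , oddCell P

  oddCell-P4 : induced4 G (fourVerts α β) ≅ᵃ P4 → ∃₂ (OddCell true zero (suc zero))
  oddCell-P4 iso = oneCell⇒oddCell (cellCount≡1⇒OneCell (block zero (suc zero))
    (2*[2+]-injective (trans (sym arcCount-fourVerts) (sym (arcCount-≅ᵃ {b = P4} iso)))))

  oddCell-K4-e : induced4 G (fourVerts α β) ≅ᵃ K4-e → ∃₂ (OddCell false zero (suc zero))
  oddCell-K4-e iso = oneCell⇒oddCell (cellCount≡3⇒OneCell (block zero (suc zero))
    (2*[2+]-injective (trans (sym arcCount-fourVerts) (sym (arcCount-≅ᵃ {b = K4-e} iso)))))

  edge-transitive : ∀ i k → ∃₂ λ σ s → IsAut G σ × Sends σ i k s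
  edge-transitive i k with two i (other i) k (other k) (other≢ i) (other≢ k)
  ... | σ , aut , _ , i↦k , _ with orientation σ i k i↦k
  ... | s , σi = σ , s , aut , σi

  flip⇒regular : ∀ {σ i} → IsAut G σ → Sends σ i i true → Regular G
  flip⇒regular {σ} {i} aut flips = degree G (end i false) , λ v → degree-end (end-surjective v)
    where
    open ≡-Reasoning
    degree-side : ∀ b → degree G (end i b) ≡ degree G (end i false)
    degree-side false = refl
    degree-side true  = trans (cong (degree G) (sym (image flips false))) (degree-aut G σ aut (end i false))
    degree-end : ∀ {v} → ∃₂ (λ j b → end j b ≡ v) → degree G v ≡ degree G (end i false)
    degree-end (j , b , refl) with edge-transitive i j
    ... | τ , s , autτ , τi = begin
      degree G (end j b)                  ≡⟨ cong (λ b′ → degree G (end j b′)) (sym (xor-cancelˡ s b)) ⟩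
      degree G (end j (s xor (s xor b)))  ≡⟨ cong (degree G) (sym (image τi (s xor b))) ⟩
      degree G (to τ (end i (s xor b)))   ≡⟨ degree-aut G τ autτ (end i (s xor b)) ⟩
      degree G (end i (s xor b))          ≡⟨ degree-side (s xor b) ⟩
      degree G (end i false)              ∎

  oddCell-spread : ∀ {w p q} → OddCell w zero (suc zero) p q → ∀ {i j} → i ≢ j → ∃₂ (OddCell w i j)
  oddCell-spread P {i} {j} i≢j with two zero (suc zero) i j (λ ()) i≢j
  ... | σ , aut , _ , 0↦i , 1↦j with orientation σ zero i 0↦i | orientation σ (suc zero) j 1↦j
  ... | s , σ0 | t , σ1 = _ , _ , oddCell-transport aut σ0 σ1 P

  oddCell-row-independent : ¬ Regular G → ∀ {w i j j′ p q p′ q′} → i ≢ j → i ≢ j′ →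
    OddCell w i j p q → OddCell w i j′ p′ q′ → p′ ≡ p
  oddCell-row-independent irregular {i = i} {j} {j′} {p = p} i≢j i≢j′ P P′ with two i j i j′ i≢j i≢j′
  ... | σ , aut , _ , i↦i , j↦j′ with orientation σ i i i↦i | orientation σ j j′ j↦j′
  ... | true  , σi | _ , _  = ⊥-elim (irregular (flip⇒regular aut σi))
  ... | false , σi | t , σj =
    trans (proj₁ (oddCell-unique (oddCell-transport aut σi σj P) P′)) (xor-identityʳ p)

  module Classification (irregular : ¬ Regular G) (w : Bool) {p₀ q₀ : Bool}
                        (base : OddCell w zero (suc zero) p₀ q₀) where

    oddSide : Fin (suc (suc k)) → Bool
    oddSide i = proj₁ (oddCell-spread base (other≢ i))

    oddCell-oddSide : ∀ {i j} → i ≢ j → OddCell w i j (oddSide i) (oddSide j)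
    oddCell-oddSide {i} {j} i≢j with oddCell-spread base i≢j
    ... | p , q , P =
      subst₂ (OddCell w i j) (row≡oddSide i≢j P) (row≡oddSide (i≢j ∘ sym) (oddCell-transpose P)) P
      where
      row≡oddSide : ∀ {i j p q} → i ≢ j → OddCell w i j p q → p ≡ oddSide i
      row≡oddSide {i} i≢j =
        oddCell-row-independent irregular (other≢ i) i≢j (proj₂ (proj₂ (oddCell-spread base (other≢ i))))

    -- The clique consists of the odd endpoints when w = true and of the other endpoints when w = false.
    cliqueSide : Fin (suc (suc k)) → Bool
    cliqueSide i = oddSide i xor not w

    vertex : Fin (suc (suc k)) ⊎ Fin (suc (suc k)) → Fin n
    vertex = to (relabel↔ cliqueSide)

    relabel-cross : ∀ x y → reduce x ≢ reduce y →
      adj G (vertex x) (vertex y) ≡ oneCell w (not w) (not w) (side x) (side y)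
    relabel-cross x y i≢j = begin
      block i j (c i xor side x) (c j xor side y)
        ≡⟨ entries (oddCell-oddSide i≢j) _ _ ⟩
      oneCell w (h i) (h j) (c i xor side x) (c j xor side y)
        ≡⟨ oneCell-shift w (h i) (h j) (c i) (c j) (side x) (side y) ⟩
      oneCell w (h i xor c i) (h j xor c j) (side x) (side y)
        ≡⟨ cong₂ (λ p q → oneCell w p q (side x) (side y))
                 (xor-cancelˡ (h i) (not w)) (xor-cancelˡ (h j) (not w)) ⟩
      oneCell w (not w) (not w) (side x) (side y) ∎
      where
      open ≡-Reasoning
      i = reduce x
      j = reduce y
      h = oddSide
      c = cliqueSide

    relabel-matchedSplit : ∀ x y → adj G (vertex x) (vertex y) ≡ matchedSplit w (suc (suc k)) x y
    relabel-matchedSplit x y with reduce x ≟ reduce y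
    ... | yes e = relabel-diagonal cliqueSide x y e
    ... | no ne = relabel-cross x y ne

    classification : ∀ {R} → (∀ x y → R x y ≡ matchedSplit w (suc (suc k)) x y) → adj G ≅ᵃ R
    classification R≗ = ≅ᵃ-via (relabel↔ cliqueSide) λ x y → trans (relabel-matchedSplit x y) (sym (R≗ x y))

  classify : ¬ Regular G → ∀ {w} → ∃₂ (OddCell w zero (suc zero)) →
    ∀ {R} → (∀ x y → R x y ≡ matchedSplit w (suc (suc k)) x y) → adj G ≅ᵃ R
  classify irregular {w} (_ , _ , base) = Classification.classification irregular w base

lemma6p12 : (k n : ℕ) (G : Graph (Fin n)) (α β : Fin (suc (suc k)) → Fin n) →
    Connected G → IsPerfectMatching G α β → StabTwoTransitive G α β →
    ((induced4 G (fourVerts α β) ≅ᵃ P4) → ¬ Regular G → adj G ≅ᵃ KmVeebar (suc (suc k)))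
    × ((induced4 G (fourVerts α β) ≅ᵃ K4-e) → ¬ Regular G → adj G ≅ᵃ KmVee (suc (suc k)))
lemma6p12 k n G α β _ pm two =
    (λ iso irregular → classify irregular (oddCell-P4 iso) (KmVeebar≗matchedSplit _))
  , (λ iso irregular → classify irregular (oddCell-K4-e iso) (KmVee≗matchedSplit _))
  where open EdgeTransitive G α β pm two
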